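{- Let $D$ be a connected Eulerian digraph. Then $D$ has a unique partition into cycles if and only if $D\in\mathcal{S}$.
   Context: A digraph is a triple $D=(V(D),E(D),\psi)$ with finite sets and $\psi:E(D)\to V(D)\times V(D)$ having distinct coordinates (no loops; parallel edges allowed). Walks follow edge directions; a circuit is a closed trail up to cyclic rotation; a cycle is a circuit with no repeated vertices; $\mathcal{B}(D)$ is the set of cycles. $D$ is Eulerian if it has a closed trail traversing every edge. A partition of $D$ into cycles is a set $\mathcal{A}\subseteq\mathcal{B}(D)$ whose edge sets partition $E(D)$. For digraphs $D_1,D_2$ with exactly one common vertex, $D_1\ast D_2$ is their union; $\mathcal{S}$ is the closure of the collection of all finite directed cycles under $\ast$. -}

module Defs where

open import Data.Nat using (ℕ)
open import Data.Fin using (Fin)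
open import Data.Fin.Subset using (Subset) renaming (_∈_ to _∈ₛ_)
open import Data.List using (List; []; _∷_; _∷ʳ_; _++_; map; concat)
open import Data.List.Membership.Propositional using (_∈_)
open import Data.List.Relation.Unary.All using (All)
open import Data.List.Relation.Unary.Any using (Any)
open import Data.List.Relation.Unary.Linked using (Linked)
open import Data.List.Relation.Unary.Unique.Propositional using (Unique)
open import Data.Product using (Σ; ∃; ∃-syntax; _×_; _,_)
open import Data.Sum using (_⊎_)
open import Data.Empty using (⊥)
open import Relation.Nullary using (¬_)
open import Relation.Binary.PropositionalEquality using (_≡_)
open import Relation.Binary.Construct.Closure.ReflexiveTransitive using (Star)
open import Function.Bundles using (_⇔_)

record Digraph : Set where
  field
    n   : ℕ
    m   : ℕ
    src : Fin m → Fin n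
    tgt : Fin m → Fin n
    noLoop : ∀ e → ¬ (src e ≡ tgt e)

module _ (D : Digraph) where
  open Digraph D

  Consec : Fin m → Fin m → Set
  Consec e f = tgt e ≡ src f

  -- a closed walk, given as a nonempty list of edges e₀ … e_{k-1}
  -- with tgt eᵢ = src eᵢ₊₁ and tgt e_{k-1} = src e₀
  IsClosedWalk : List (Fin m) → Set
  IsClosedWalk [] = ⊥
  IsClosedWalk (e ∷ es) = Linked Consec ((e ∷ es) ∷ʳ e)

  IsClosedTrail : List (Fin m) → Set
  IsClosedTrail es = IsClosedWalk es × Unique es

  IsCycle : List (Fin m) → Set
  IsCycle es = IsClosedWalk es × Unique (map src es)

  Eulerian : Set
  Eulerian = ∃[ es ] (IsClosedTrail es × (∀ e → e ∈ es))

  Adj : Fin n → Fin n → Set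
  Adj u v = ∃[ e ] ((src e ≡ u × tgt e ≡ v) ⊎ (src e ≡ v × tgt e ≡ u))

  Connected : Set
  Connected = ∀ u v → Star Adj u v

  IsCyclePartition : List (List (Fin m)) → Set
  IsCyclePartition P = All IsCycle P × Unique (concat P) × (∀ e → e ∈ concat P)

  SameUpToRotation : List (Fin m) → List (Fin m) → Set
  SameUpToRotation c c' = ∃[ xs ] ∃[ ys ] (c ≡ xs ++ ys × c' ≡ ys ++ xs)

  -- equality of two collections of cycles, as sets of cycles (mod rotation)
  SameCycleSet : List (List (Fin m)) → List (List (Fin m)) → Set
  SameCycleSet P Q =
    All (λ c → Any (SameUpToRotation c) Q) P ×
    All (λ c → Any (SameUpToRotation c) P) Q

  HasUniqueCyclePartition : Set
  HasUniqueCyclePartition =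
    (∃[ P ] IsCyclePartition P) ×
    (∀ P Q → IsCyclePartition P → IsCyclePartition Q → SameCycleSet P Q)

  IsDirectedCycleSub : Subset n → Subset m → Set
  IsDirectedCycleSub VS ES = ∃[ c ] (IsCycle c ×
    (∀ e → (e ∈ₛ ES) ⇔ (e ∈ c)) × (∀ v → (v ∈ₛ VS) ⇔ (v ∈ map src c)))

  -- Membership of the sub-digraph (VS , ES) in the class 𝒮: the least class
  -- containing directed cycles and closed under D₁ ∗ D₂ (union of two
  -- digraphs having exactly one common vertex).
  data InS : Subset n → Subset m → Set where
    cycle : ∀ {VS ES} → IsDirectedCycleSub VS ES → InS VS ES
    glue  : ∀ {VS ES} V₁ E₁ V₂ E₂ →
            InS V₁ E₁ → InS V₂ E₂ →
            (∃[ w ] ∀ u → ((u ∈ₛ V₁) × (u ∈ₛ V₂)) ⇔ (u ≡ w)) →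
            (∀ v → (v ∈ₛ VS) ⇔ ((v ∈ₛ V₁) ⊎ (v ∈ₛ V₂))) →
            (∀ e → (e ∈ₛ ES) ⇔ ((e ∈ₛ E₁) ⊎ (e ∈ₛ E₂))) →
            InS VS ES

  InClassS : Set
  InClassS = InS Data.Fin.Subset.⊤ Data.Fin.Subset.⊤

{-# OPTIONS --safe #-}
module Submission where

-- (⇐) A cycle of D₁ ∗ D₂ lies entirely in D₁ or in D₂: it could only pass from one to the
-- other at the common vertex, and it visits that vertex once. So, by induction over 𝒮, the
-- building cycles partition D and two cycles of D sharing an edge are rotations of each other;
-- hence every cycle partition consists of the building cycles.
-- (⇒) Connectivity lets us order the blocks of the unique partition so that each block meets
-- the union Q of the later ones; gluing them in this order builds D in 𝒮, provided each block C
-- meets Q in a single vertex. If C met Q in u ≠ v, cut C and an Euler tour of Q at u and v: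
-- u → v along C, back along the tour, and v → u along C, back along the tour, are closed
-- walks whose cycles, with the remaining blocks, form a cycle partition separating two edges
-- of C, contradicting uniqueness.

open import Defs
open import Function.Bundles using (_⇔_; mk⇔; Equivalence)

open import Data.Empty using (⊥; ⊥-elim)
open import Data.Fin using (Fin) renaming (_≟_ to _≟ᶠ_)
open import Data.Fin.Subset using (Subset; ⊤) renaming (_∈_ to _∈ₛ_)
open import Data.Fin.Subset.Properties using (∈⊤)
open import Data.List using (List; []; _∷_; _++_; [_]; map; concat; length)
import Data.List.Properties as List
open import Data.List.Membership.Propositional using (_∈_; _∉_; find; lose)
open import Data.List.Membership.Propositional.Properties
  using (∈-++⁺ˡ; ∈-++⁺ʳ; ∈-++⁻; ++-∈⇔; ∈-∃++; ∈-map⁺; ∈-concat⁺′; ∈-concat⁻′)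
open import Data.List.Relation.Binary.Disjoint.Propositional using (Disjoint)
open import Data.List.Relation.Binary.Permutation.Propositional
  using ( _↭_; refl; prep; swap; trans; ↭-sym; ↭-trans; ↭-reflexive; ↭⇒↭ₛ
        ; module PermutationReasoning)
open import Data.List.Relation.Binary.Permutation.Propositional.Properties
  using ( All-resp-↭; ∈-resp-↭; map⁺; ++⁺ˡ; ++⁺; ++-comm; ++-identityʳ; shift; shifts
        ; ↭-length; ↭-empty-inv)
import Data.List.Relation.Binary.Permutation.Setoid.Properties as Permutationₛ
open import Data.List.Relation.Binary.Subset.Propositional using (_⊆_)
open import Data.List.Relation.Binary.Subset.Propositional.Properties
  using (xs⊆x∷xs; ∷⁺ʳ; ⊆∷∧∉⇒⊆)
open import Data.List.Relation.Unary.All as All using (All; []; _∷_)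
import Data.List.Relation.Unary.All.Properties as All
import Data.List.Relation.Unary.AllPairs as AllPairs
open import Data.List.Relation.Unary.Any using (Any; here; there; any?)
open import Data.List.Relation.Unary.Linked using (Linked; [-]; _∷_)
open import Data.List.Relation.Unary.Unique.Propositional using (Unique; []; _∷_)
import Data.List.Relation.Unary.Unique.Propositional.Properties as Unique
open import Data.Nat.Base using (ℕ; suc)
import Data.Nat.Properties as ℕ
open import Data.Product using (∃; ∃₂; _×_; _,_; proj₁; proj₂)
open import Data.Sum using (_⊎_; inj₁; inj₂)
import Data.Sum as Sum
open import Data.Sum.Function.Propositional using (_⊎-⇔_)
open import Function.Base using (_∘_)
import Function.Properties.Equivalence as ⇔
import Relation.Binary.Construct.Closure.ReflexiveTransitive as Star
open import Relation.Binary.PropositionalEquality using (_≡_; _≢_; refl; sym; subst; cong; setoid)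
import Relation.Binary.PropositionalEquality as ≡
open import Relation.Nullary using (¬_; yes; no)

module _ {A : Set} where

  Unique-++⁻ : ∀ (xs : List A) {ys} → Unique (xs ++ ys) → Unique xs × Unique ys × Disjoint xs ys
  Unique-++⁻ []       u         = [] , u , λ ()
  Unique-++⁻ (x ∷ xs) (x∉ ∷ u) with Unique-++⁻ xs u
  ... | uxs , uys , xs#ys = All.++⁻ˡ xs x∉ ∷ uxs , uys , λ where
    (here refl , v∈ys)  → All.lookup (All.++⁻ʳ xs x∉) v∈ys refl
    (there v∈xs , v∈ys) → xs#ys (v∈xs , v∈ys)

  Unique-resp-↭ : ∀ {xs ys : List A} → xs ↭ ys → Unique xs → Unique ys
  Unique-resp-↭ p = Permutationₛ.Unique-resp-↭ (setoid A) (↭⇒↭ₛ p)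

  ∈-∃↭ : ∀ {x : A} {xs} → x ∈ xs → ∃ λ ys → xs ↭ x ∷ ys
  ∈-∃↭ x∈xs with ys , zs , refl ← ∈-∃++ x∈xs = ys ++ zs , shift _ ys zs

  concat-↭ : ∀ {xss yss : List (List A)} → xss ↭ yss → concat xss ↭ concat yss
  concat-↭ refl           = refl
  concat-↭ (prep xs p)    = ++⁺ˡ xs (concat-↭ p)
  concat-↭ (swap xs ys p) = ↭-trans (shifts xs ys) (++⁺ˡ ys (++⁺ˡ xs (concat-↭ p)))
  concat-↭ (trans p q)    = ↭-trans (concat-↭ p) (concat-↭ q)

  no-straddling-block : ∀ (Xs : List (List A)) {Ys B h g} → Unique (concat (Xs ++ Ys)) →
                        B ∈ Xs ++ Ys → h ∈ B → g ∈ B → h ∈ concat Xs → g ∈ concat Ys → ⊥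
  no-straddling-block Xs {Ys} u B∈ h∈B g∈B h∈Xs g∈Ys
    with _ , _ , Xs#Ys ← Unique-++⁻ (concat Xs) (subst Unique (sym (List.concat-++ Xs Ys)) u)
    with ∈-++⁻ Xs B∈
  ... | inj₁ B∈Xs = Xs#Ys (∈-concat⁺′ g∈B B∈Xs , g∈Ys)
  ... | inj₂ B∈Ys = Xs#Ys (h∈Xs , ∈-concat⁺′ h∈B B∈Ys)

module _ {k : ℕ} where
  open import Data.List.Membership.DecPropositional (_≟ᶠ_ {k}) using (_∈?_)
  open import Data.Vec.Base using (tabulate)
  open import Data.Vec.Properties using (lookup∘tabulate; []=⇒lookup; lookup⇒[]=)
  open import Data.Bool.Properties using (T-≡)
  open import Relation.Nullary.Decidable using (⌊_⌋; toWitness; fromWitness)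

  fromList : List (Fin k) → Subset k
  fromList xs = tabulate (λ x → ⌊ x ∈? xs ⌋)

  ∈-fromList : ∀ {x xs} → x ∈ₛ fromList xs ⇔ x ∈ xs
  ∈-fromList {x} {xs} = mk⇔
    (λ x∈ → toWitness (Equivalence.from T-≡ (≡.trans (sym (lookup∘tabulate _ x)) ([]=⇒lookup x∈))))
    (λ x∈ → lookup⇒[]= x _ (≡.trans (lookup∘tabulate _ x) (Equivalence.to T-≡ (fromWitness x∈))))

  ∈-++⇔∈-fromList : ∀ {x xs ys} → x ∈ xs ++ ys ⇔ (x ∈ₛ fromList xs ⊎ x ∈ₛ fromList ys)
  ∈-++⇔∈-fromList = ⇔.trans ++-∈⇔ (⇔.sym ∈-fromList ⊎-⇔ ⇔.sym ∈-fromList)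

module _ (D : Digraph) where
  open Digraph D
  open import Data.List.Membership.DecPropositional (_≟ᶠ_ {n}) using (_∈?_)

  -- Walks

  data Walk : Fin n → Fin n → List (Fin m) → Set where
    nil  : ∀ {a} → Walk a a []
    cons : ∀ {a b e es} → src e ≡ a → Walk (tgt e) b es → Walk a b (e ∷ es)

  -- The vertices of a walk along es ending in b, with the endpoint listed first.
  visits : Fin n → List (Fin m) → List (Fin n)
  visits b es = b ∷ map src es

  visits-⊆ : ∀ {b e es} → visits b es ⊆ visits b (e ∷ es)
  visits-⊆ {b} {e} {es} = ∷⁺ʳ b (xs⊆x∷xs (map src es) (src e))

  visits-++ : ∀ {b} p q → visits b (p ++ q) ↭ map src p ++ visits b q
  visits-++ {b} p q =
    ↭-trans (↭-reflexive (cong (b ∷_) (List.map-++ src p q)))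
            (↭-sym (shift b (map src p) (map src q)))

  walk-++ : ∀ {a b c p q} → Walk a b p → Walk b c q → Walk a c (p ++ q)
  walk-++ nil          wq = wq
  walk-++ (cons e↦ wp) wq = cons e↦ (walk-++ wp wq)

  walk-++⁻ : ∀ {a c} p {q} → Walk a c (p ++ q) → ∃ λ b → Walk a b p × Walk b c q
  walk-++⁻ []      w           = _ , nil , w
  walk-++⁻ (e ∷ p) (cons e↦ w) with b , wp , wq ← walk-++⁻ p w = b , cons e↦ wp , wq

  walk-start : ∀ {a b es} → Walk a b es → a ∈ visits b es
  walk-start nil         = here refl
  walk-start (cons e↦ _) = there (here (sym e↦))

  walk-splitAt : ∀ {a b c es} → Walk a c es → b ∈ visits c es →
                 ∃₂ λ p q → es ≡ p ++ q × Walk a b p × Walk b c q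
  walk-splitAt nil                 (here refl)         = [] , [] , refl , nil , nil
  walk-splitAt w@(cons refl _)     (there (here refl)) = [] , _ , refl , nil , w
  walk-splitAt (cons {e = e} e↦ w) (here refl)
    with p , q , refl , wp , wq ← walk-splitAt w (here refl) = e ∷ p , q , refl , cons e↦ wp , wq
  walk-splitAt (cons {e = e} e↦ w) (there (there b∈))
    with p , q , refl , wp , wq ← walk-splitAt w (there b∈) = e ∷ p , q , refl , cons e↦ wp , wq

  walk-tgt∈ : ∀ {a b e es} → Walk a b es → e ∈ es → tgt e ∈ visits b es
  walk-tgt∈ (cons _ w) (here refl) = visits-⊆ (walk-start w)
  walk-tgt∈ (cons _ w) (there e∈)  = visits-⊆ (walk-tgt∈ w e∈)

  closedWalk-tgt∈ : ∀ {a e es} → Walk a a es → e ∈ es → tgt e ∈ map src es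
  closedWalk-tgt∈ w@(cons e↦a _) e∈ with walk-tgt∈ w e∈
  ... | here refl = here (sym e↦a)
  ... | there t∈  = t∈

  Linked⇒Walk : ∀ e es f → Linked (Consec D) (e ∷ es ++ [ f ]) → Walk (src e) (src f) (e ∷ es)
  Linked⇒Walk e []        f (e→f ∷ [-])     = cons refl (subst (λ v → Walk (tgt e) v []) e→f nil)
  Linked⇒Walk e (e′ ∷ es) f (e→e′ ∷ linked) =
    cons refl (subst (λ v → Walk v (src f) (e′ ∷ es)) (sym e→e′) (Linked⇒Walk e′ es f linked))

  walk-[] : ∀ {a b} → Walk a b [] → a ≡ b
  walk-[] nil = refl

  Walk⇒Linked : ∀ {a} e es f → Walk a (src f) (e ∷ es) → Linked (Consec D) (e ∷ es ++ [ f ])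
  Walk⇒Linked e []        f (cons _ w)              = walk-[] w ∷ [-]
  Walk⇒Linked e (e′ ∷ es) f (cons _ w@(cons e′↦ _)) = sym e′↦ ∷ Walk⇒Linked e′ es f w

  closedWalk⇒Walk : ∀ {es} → IsClosedWalk D es → ∃ λ a → Walk a a es
  closedWalk⇒Walk {e ∷ es} closed = src e , Linked⇒Walk e es e closed

  Walk⇒closedWalk : ∀ {a e es} → Walk a a (e ∷ es) → IsClosedWalk D (e ∷ es)
  Walk⇒closedWalk {e = e} {es} w@(cons refl _) = Walk⇒Linked e es e w

  cycle⇒Walk : ∀ {C} → IsCycle D C → ∃ λ a → Walk a a C
  cycle⇒Walk (closed , _) = closedWalk⇒Walk closed

  walk⇒path+cycles : ∀ {a b es} → Walk a b es →
                     ∃₂ λ p Ps → Walk a b p × Unique (visits b p) ×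
                                 All (IsCycle D) Ps × p ++ concat Ps ↭ es
  walk⇒path+cycles nil = [] , [] , nil , [] ∷ [] , [] , refl
  walk⇒path+cycles {b = b} (cons {e = e} refl w)
    with p , Ps , wp , p-path , cycles , p+Ps↭ ← walk⇒path+cycles w
    with src e ∈? visits b p
  ... | no e∉ =
    e ∷ p , Ps , cons refl wp , Unique-resp-↭ (swap _ _ refl) (All.¬Any⇒All¬ _ e∉ ∷ p-path) ,
    cycles , prep e p+Ps↭
  ... | yes e∈ with q , r , refl , wq , wr ← walk-splitAt wp e∈
    with q-unique , r-path , q#r ← Unique-++⁻ (map src q) (Unique-resp-↭ (visits-++ q r) p-path) =
    r , (e ∷ q) ∷ Ps , wr , r-path , (Walk⇒closedWalk (cons refl wq) , e∷q-unique) ∷ cycles , perm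
    where
      e∷q-unique : Unique (map src (e ∷ q))
      e∷q-unique = All.¬Any⇒All¬ _ (λ e∈q → q#r (e∈q , walk-start wr)) ∷ q-unique
      open PermutationReasoning
      perm : r ++ e ∷ q ++ concat Ps ↭ e ∷ _
      perm = begin
        r ++ e ∷ q ++ concat Ps    ↭⟨ shift e r _ ⟩
        e ∷ r ++ q ++ concat Ps    ↭⟨ prep e (shifts r q) ⟩
        e ∷ q ++ r ++ concat Ps    ≡⟨ cong (e ∷_) (List.++-assoc q r _) ⟨
        e ∷ (q ++ r) ++ concat Ps  ↭⟨ prep e p+Ps↭ ⟩
        e ∷ _                      ∎

  closedWalk⇒cycles : ∀ {a es} → Walk a a es → ∃ λ Ps → All (IsCycle D) Ps × concat Ps ↭ es
  closedWalk⇒cycles w with walk⇒path+cycles w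
  ... | []    , Ps , _ , _ , cycles , Ps↭ = Ps , cycles , Ps↭
  ... | _ ∷ _ , _ , cons refl _ , a∉ ∷ _ , _ = ⊥-elim (All.head a∉ refl)

  walk-rotate : ∀ {a b es} → Walk a a es → b ∈ map src es → ∃ λ rs → Walk b b rs × rs ↭ es
  walk-rotate w b∈ with p , q , refl , wp , wq ← walk-splitAt w (there b∈) =
    q ++ p , walk-++ wq wp , ++-comm q p

  closedWalk-split₂ : ∀ {a u v es} → Walk a a es → u ∈ map src es → v ∈ map src es →
                      ∃₂ λ p q → Walk u v p × Walk v u q × p ++ q ↭ es
  closedWalk-split₂ w u∈ v∈ with rs , wr , rs↭es ← walk-rotate w u∈
    with p , q , refl , wp , wq ← walk-splitAt wr (there (∈-resp-↭ (map⁺ src (↭-sym rs↭es)) v∈)) =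
    p , q , wp , wq , rs↭es

  path-⊆⇒≡ : ∀ {a b xs ys} → Walk b a xs → Walk b a ys →
             Unique (visits a xs) → Unique (visits a ys) → xs ⊆ ys → xs ≡ ys
  path-⊆⇒≡ nil           nil           _  _            _     = refl
  path-⊆⇒≡ nil           (cons refl _) _  (a∉ ∷ _)     _     = ⊥-elim (All.head a∉ refl)
  path-⊆⇒≡ (cons _ _)    nil           _  _            xs⊆ys with () ← xs⊆ys (here refl)
  path-⊆⇒≡ {a} (cons {e = x} refl wx) (cons y↦ wy) ux uy xs⊆ys with xs⊆ys (here refl)
  ... | there x∈ys = ⊥-elim (Unique.Unique[x∷xs]⇒x∉xs (AllPairs.tail uy)
                                                   (subst (_∈ map src _) (sym y↦) (∈-map⁺ src x∈ys)))
  ... | here refl =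
    cong (x ∷_) (path-⊆⇒≡ wx wy (drop-src ux) (drop-src uy) (⊆∷∧∉⇒⊆ (xs⊆ys ∘ there) x∉xs))
    where
      drop-src : ∀ {es} → Unique (visits a (x ∷ es)) → Unique (visits a es)
      drop-src u = AllPairs.tail (Unique-resp-↭ (swap a (src x) refl) u)
      x∉xs : x ∉ _
      x∉xs x∈xs = Unique.Unique[x∷xs]⇒x∉xs (AllPairs.tail ux) (∈-map⁺ src x∈xs)

  cycle-⊆⇒rotation : ∀ {C C′} → IsCycle D C → IsCycle D C′ → C ⊆ C′ →
                     SameUpToRotation D C C′
  cycle-⊆⇒rotation {e ∷ es} (closed , C-unique) C′-cycle C⊆C′
    with _ , wC′ ← cycle⇒Walk C′-cycle
    with p , q , refl ← ∈-∃++ (C⊆C′ (here refl))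
    with _ , wp , cons refl wq ← walk-++⁻ p wC′
    with cons _ wes ← Linked⇒Walk e es e closed =
    e ∷ q , p , cong (e ∷_) (path-⊆⇒≡ wes (walk-++ wq wp) C-unique rotated-unique es⊆q++p) , refl
    where
      rotate : p ++ e ∷ q ↭ e ∷ q ++ p
      rotate = ++-comm p (e ∷ q)
      rotated-unique : Unique (visits (src e) (q ++ p))
      rotated-unique = Unique-resp-↭ (map⁺ src rotate) (proj₂ C′-cycle)
      es⊆q++p : es ⊆ q ++ p
      es⊆q++p x∈es with ∈-resp-↭ rotate (C⊆C′ (there x∈es))
      ... | here refl = ⊥-elim (Unique.Unique[x∷xs]⇒x∉xs C-unique (∈-map⁺ src x∈es))
      ... | there x∈  = x∈

  rotation⇒↭ : ∀ {C C′} → SameUpToRotation D C C′ → C ↭ C′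
  rotation⇒↭ (xs , ys , refl , refl) = ++-comm xs ys

  cycle-endpoints : ∀ {C e} → IsCycle D C → e ∈ C → src e ∈ map src C × tgt e ∈ map src C
  cycle-endpoints C-cycle e∈ = ∈-map⁺ src e∈ , closedWalk-tgt∈ (proj₂ (cycle⇒Walk C-cycle)) e∈

  -- Members of 𝒮

  IsSubdigraph : Subset n → Subset m → Set
  IsSubdigraph VS ES = ∀ {e} → e ∈ₛ ES → src e ∈ₛ VS × tgt e ∈ₛ VS

  InS⇒IsSubdigraph : ∀ {VS ES} → InS D VS ES → IsSubdigraph VS ES
  InS⇒IsSubdigraph (cycle (C , C-cycle , edges , vertices)) e∈
    with s∈ , t∈ ← cycle-endpoints C-cycle (Equivalence.to (edges _) e∈) =
    Equivalence.from (vertices _) s∈ , Equivalence.from (vertices _) t∈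
  InS⇒IsSubdigraph (glue _ _ _ _ S₁ S₂ _ vertices edges) e∈ with Equivalence.to (edges _) e∈
  ... | inj₁ e∈₁ = let s∈ , t∈ = InS⇒IsSubdigraph S₁ e∈₁ in
                   Equivalence.from (vertices _) (inj₁ s∈) , Equivalence.from (vertices _) (inj₁ t∈)
  ... | inj₂ e∈₂ = let s∈ , t∈ = InS⇒IsSubdigraph S₂ e∈₂ in
                   Equivalence.from (vertices _) (inj₂ s∈) , Equivalence.from (vertices _) (inj₂ t∈)

  consec-stays : ∀ {V E V′ E′ w a b} → IsSubdigraph V E → IsSubdigraph V′ E′ →
                 (∀ {u} → u ∈ₛ V → u ∈ₛ V′ → u ≡ w) →
                 Consec D a b → src b ≢ w × (b ∈ₛ E ⊎ b ∈ₛ E′) → a ∈ₛ E → b ∈ₛ E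
  consec-stays _   _    _      _   (_   , inj₁ b∈)  _  = b∈
  consec-stays sub sub′ common a→b (b≢w , inj₂ b∈′) a∈ =
    ⊥-elim (b≢w (common (subst (_∈ₛ _) a→b (proj₂ (sub a∈))) (proj₁ (sub′ b∈′))))

  walk-propagate : ∀ {P Q : Fin m → Set} → (∀ {a b} → Consec D a b → Q b → P a → P b) →
                   ∀ {x y e es} → Walk x y (e ∷ es) → All Q es → P e → All P (e ∷ es)
  walk-propagate step (cons _ nil)           []        pe = pe ∷ []
  walk-propagate step (cons _ w@(cons f↦ _)) (qf ∷ qs) pe =
    pe ∷ walk-propagate step w qs (step (sym f↦) qf pe)

  cycle-rotation-avoiding : ∀ {C} → IsCycle D C → ∀ w →
                            ∃₂ λ f fs → (∃ λ a → Walk a a (f ∷ fs)) × f ∷ fs ↭ C ×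
                                        All (λ b → src b ≢ w) fs
  cycle-rotation-avoiding {[]}     (() , _) w
  cycle-rotation-avoiding {f ∷ fs} C-cycle  w with w ∈? map src (f ∷ fs)
  ... | no w∉ =
    f , fs , cycle⇒Walk C-cycle , refl , All.tabulate (λ b∈ b≡w → w∉ (there (b∈⇒w∈ b∈ b≡w)))
    where b∈⇒w∈ : ∀ {b} → b ∈ fs → src b ≡ w → w ∈ map src fs
          b∈⇒w∈ b∈ refl = ∈-map⁺ src b∈
  ... | yes w∈ with walk-rotate (proj₂ (cycle⇒Walk C-cycle)) w∈
  ... | [] , _ , []↭C with () ← ↭-empty-inv (↭-sym []↭C)
  ... | g ∷ gs , wr@(cons refl _) , r↭C =
    g , gs , (_ , wr) , r↭C ,
    All.map (λ g≢b b≡g → g≢b (sym b≡g)) (All.map⁻ (AllPairs.head r-unique))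
    where r-unique : Unique (map src (g ∷ gs))
          r-unique = Unique-resp-↭ (map⁺ src (↭-sym r↭C)) (proj₂ C-cycle)

  EdgeDeterminesCycle : Subset m → Set
  EdgeDeterminesCycle ES = ∀ {C C′ e} → IsCycle D C → IsCycle D C′ → All (_∈ₛ ES) C → All (_∈ₛ ES) C′ →
                           e ∈ C → e ∈ C′ → SameUpToRotation D C C′

  IsCyclePartitionOf : Subset m → List (List (Fin m)) → Set
  IsCyclePartitionOf ES P =
    All (IsCycle D) P × Unique (concat P) × (∀ e → e ∈ concat P ⇔ e ∈ₛ ES)

  module Gluing {V₁ E₁ V₂ E₂ w} (sub₁ : IsSubdigraph V₁ E₁) (sub₂ : IsSubdigraph V₂ E₂)
                (one : ∀ u → (u ∈ₛ V₁ × u ∈ₛ V₂) ⇔ (u ≡ w)) where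

    common : ∀ {u} → u ∈ₛ V₁ → u ∈ₛ V₂ → u ≡ w
    common u∈₁ u∈₂ = Equivalence.to (one _) (u∈₁ , u∈₂)

    edges-disjoint : ∀ {e} → e ∈ₛ E₁ → e ∈ₛ E₂ → ⊥
    edges-disjoint e∈₁ e∈₂ =
      noLoop _ (≡.trans (common (proj₁ (sub₁ e∈₁)) (proj₁ (sub₂ e∈₂)))
                        (sym (common (proj₂ (sub₁ e∈₁)) (proj₂ (sub₂ e∈₂)))))

    -- Rotated to start at w, the cycle could only change sides at w, which it never revisits.
    cycle-one-sided : ∀ {C} → IsCycle D C → All (λ e → e ∈ₛ E₁ ⊎ e ∈ₛ E₂) C →
                      All (_∈ₛ E₁) C ⊎ All (_∈ₛ E₂) C
    cycle-one-sided C-cycle sides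
      with f , fs , (_ , wr) , r↭C , avoid ← cycle-rotation-avoiding C-cycle w
      with All-resp-↭ (↭-sym r↭C) sides
    ... | inj₁ f∈₁ ∷ fs-sides =
      inj₁ (All-resp-↭ r↭C (walk-propagate (consec-stays sub₁ sub₂ common) wr
                                           (All.zip (avoid , fs-sides)) f∈₁))
    ... | inj₂ f∈₂ ∷ fs-sides =
      inj₂ (All-resp-↭ r↭C (walk-propagate (consec-stays sub₂ sub₁ (λ u∈₂ u∈₁ → common u∈₁ u∈₂)) wr
                                           (All.zip (avoid , All.map Sum.swap fs-sides)) f∈₂))

    glue-EdgeDeterminesCycle : ∀ {ES} → (∀ e → e ∈ₛ ES ⇔ (e ∈ₛ E₁ ⊎ e ∈ₛ E₂)) →
                               EdgeDeterminesCycle E₁ → EdgeDeterminesCycle E₂ →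
                               EdgeDeterminesCycle ES
    glue-EdgeDeterminesCycle edges rigid₁ rigid₂ C-cycle C′-cycle C⊆ C′⊆ e∈C e∈C′
      with cycle-one-sided C-cycle (All.map (Equivalence.to (edges _)) C⊆)
         | cycle-one-sided C′-cycle (All.map (Equivalence.to (edges _)) C′⊆)
    ... | inj₁ C⊆₁ | inj₁ C′⊆₁ = rigid₁ C-cycle C′-cycle C⊆₁ C′⊆₁ e∈C e∈C′
    ... | inj₂ C⊆₂ | inj₂ C′⊆₂ = rigid₂ C-cycle C′-cycle C⊆₂ C′⊆₂ e∈C e∈C′
    ... | inj₁ C⊆₁ | inj₂ C′⊆₂ = ⊥-elim (edges-disjoint (All.lookup C⊆₁ e∈C) (All.lookup C′⊆₂ e∈C′))
    ... | inj₂ C⊆₂ | inj₁ C′⊆₁ = ⊥-elim (edges-disjoint (All.lookup C′⊆₁ e∈C′) (All.lookup C⊆₂ e∈C))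

    glue-CyclePartition : ∀ {ES P₁ P₂} → (∀ e → e ∈ₛ ES ⇔ (e ∈ₛ E₁ ⊎ e ∈ₛ E₂)) →
                          IsCyclePartitionOf E₁ P₁ → IsCyclePartitionOf E₂ P₂ →
                          IsCyclePartitionOf ES (P₁ ++ P₂)
    glue-CyclePartition {ES} {P₁} {P₂} edges (cycles₁ , unique₁ , cover₁) (cycles₂ , unique₂ , cover₂) =
      All.++⁺ cycles₁ cycles₂ ,
      subst Unique (List.concat-++ P₁ P₂)
        (Unique.++⁺ unique₁ unique₂ λ (e∈₁ , e∈₂) →
           edges-disjoint (Equivalence.to (cover₁ _) e∈₁) (Equivalence.to (cover₂ _) e∈₂)) ,
      λ e → subst (λ es → e ∈ es ⇔ e ∈ₛ ES) (List.concat-++ P₁ P₂)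
              (⇔.trans ++-∈⇔ (⇔.trans (cover₁ e ⊎-⇔ cover₂ e) (⇔.sym (edges e))))

  InS⇒EdgeDeterminesCycle : ∀ {VS ES} → InS D VS ES → EdgeDeterminesCycle ES
  InS⇒EdgeDeterminesCycle (cycle (C₀ , C₀-cycle , edges , _)) C-cycle C′-cycle C⊆ C′⊆ _ _ =
    cycle-⊆⇒rotation C-cycle C′-cycle (∈-resp-↭ C₀↭C′ ∘ ⊆C₀ C⊆)
    where
      ⊆C₀ : ∀ {C} → All (_∈ₛ _) C → C ⊆ C₀
      ⊆C₀ C⊆ e∈ = Equivalence.to (edges _) (All.lookup C⊆ e∈)
      C₀↭C′ : C₀ ↭ _
      C₀↭C′ = ↭-sym (rotation⇒↭ (cycle-⊆⇒rotation C′-cycle C₀-cycle (⊆C₀ C′⊆)))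
  InS⇒EdgeDeterminesCycle (glue _ _ _ _ S₁ S₂ (_ , one) _ edges) =
    Gluing.glue-EdgeDeterminesCycle (InS⇒IsSubdigraph S₁) (InS⇒IsSubdigraph S₂) one edges
      (InS⇒EdgeDeterminesCycle S₁) (InS⇒EdgeDeterminesCycle S₂)

  InS⇒CyclePartition : ∀ {VS ES} → InS D VS ES → ∃ (IsCyclePartitionOf ES)
  InS⇒CyclePartition (cycle (C , C-cycle , edges , _)) =
    [ C ] , C-cycle ∷ [] , subst Unique (sym (List.++-identityʳ C)) (Unique.map⁻ (proj₂ C-cycle)) ,
    λ e → subst (λ es → e ∈ es ⇔ _) (sym (List.++-identityʳ C)) (⇔.sym (edges e))
  InS⇒CyclePartition (glue _ _ _ _ S₁ S₂ (_ , one) _ edges) =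
    _ , Gluing.glue-CyclePartition (InS⇒IsSubdigraph S₁) (InS⇒IsSubdigraph S₂) one edges
          (proj₂ (InS⇒CyclePartition S₁)) (proj₂ (InS⇒CyclePartition S₂))

  partitions-agree : EdgeDeterminesCycle ⊤ → ∀ {P Q} → IsCyclePartition D P → IsCyclePartition D Q →
                     All (λ C → Any (SameUpToRotation D C) Q) P
  partitions-agree rigid {P} {Q} (cyclesP , _) (cyclesQ , _ , coverQ) =
    All.tabulate (λ C∈P → rotation-in-Q (All.lookup cyclesP C∈P))
    where
      rotation-in-Q : ∀ {C} → IsCycle D C → Any (SameUpToRotation D C) Q
      rotation-in-Q {e ∷ _} C-cycle with C′ , e∈C′ , C′∈Q ← ∈-concat⁻′ Q (coverQ e) =
        lose C′∈Q (rigid C-cycle (All.lookup cyclesQ C′∈Q) all⊤ all⊤ (here refl) e∈C′)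
        where all⊤ : ∀ {es} → All (_∈ₛ ⊤) es
              all⊤ = All.tabulate (λ _ → ∈⊤)

  InClassS⇒HasUniqueCyclePartition : InClassS D → HasUniqueCyclePartition D
  InClassS⇒HasUniqueCyclePartition S with P , cycles , unique , cover ← InS⇒CyclePartition S =
    (P , cycles , unique , λ e → Equivalence.from (cover e) ∈⊤) ,
    λ P Q isP isQ → partitions-agree rigid isP isQ , partitions-agree rigid isQ isP
    where rigid : EdgeDeterminesCycle ⊤
          rigid = InS⇒EdgeDeterminesCycle S

  -- Digraphs with a unique cycle partition

  vertices : List (List (Fin m)) → List (Fin n)
  vertices Q = concat (map (map src) Q)

  Touches : List (Fin m) → List (List (Fin m)) → Set
  Touches C Q = Any (_∈ vertices Q) (map src C)

  data ConnectedUnion : List (List (Fin m)) → Set where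
    single : ∀ C → ConnectedUnion [ C ]
    attach : ∀ {C Q} → Touches C Q → ConnectedUnion Q → ConnectedUnion (C ∷ Q)

  cycle-vertex : ∀ {C} → IsCycle D C → ∃ λ v → v ∈ map src C
  cycle-vertex {e ∷ _} _ = src e , here refl

  ConnectedUnion-vertex : ∀ {Q} → ConnectedUnion Q → All (IsCycle D) Q → ∃ λ v → v ∈ vertices Q
  ConnectedUnion-vertex () []
  ConnectedUnion-vertex _  (C-cycle ∷ _) = let v , v∈ = cycle-vertex C-cycle in v , ∈-++⁺ˡ v∈

  vertices-↭ : ∀ {T Q} → T ↭ concat Q → vertices Q ⊆ map src T
  vertices-↭ {Q = Q} T↭Q v∈ = ∈-resp-↭ (map⁺ src (↭-sym T↭Q)) (subst (_ ∈_) (List.concat-map Q) v∈)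

  eulerTour : ∀ {Q} → ConnectedUnion Q → All (IsCycle D) Q → ∃₂ λ z T → Walk z z T × T ↭ concat Q
  eulerTour (single C) (C-cycle ∷ []) =
    let z , wC = cycle⇒Walk C-cycle in z , C , wC , ↭-sym (++-identityʳ C)
  eulerTour (attach {Q = Q} touch union) (C-cycle ∷ cycles)
    with v , v∈C , v∈Q ← find touch
    with _ , T , wT , T↭Q ← eulerTour union cycles
    with C′ , wC′ , C′↭C ← walk-rotate (proj₂ (cycle⇒Walk C-cycle)) v∈C
    with T′ , wT′ , T′↭T ← walk-rotate wT (vertices-↭ {Q = Q} T↭Q v∈Q) =
    v , C′ ++ T′ , walk-++ wC′ wT′ , ++⁺ C′↭C (↭-trans T′↭T T↭Q)

  walk-nonempty : ∀ {a b es} → Walk a b es → a ≢ b → ∃ λ e → e ∈ es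
  walk-nonempty nil        a≢a = ⊥-elim (a≢a refl)
  walk-nonempty (cons _ _) _   = _ , here refl

  -- Cut C = s₁ s₂ (u → v → u) and T = t₁ t₂ (v → u → v); the closed walks s₁ t₁ and s₂ t₂
  -- use the edges of C and T, and each takes only part of C.
  reroute : ∀ {a z u v C T} → Walk a a C → Walk z z T → u ∈ map src C → v ∈ map src C →
            u ∈ map src T → v ∈ map src T → u ≢ v →
            ∃₂ λ Ps₁ Ps₂ → All (IsCycle D) (Ps₁ ++ Ps₂) × concat Ps₁ ++ concat Ps₂ ↭ C ++ T ×
            ∃₂ λ h g → h ∈ C × g ∈ C × h ∈ concat Ps₁ × g ∈ concat Ps₂
  reroute wC wT u∈C v∈C u∈T v∈T u≢v
    with s₁ , s₂ , ws₁ , ws₂ , s↭C ← closedWalk-split₂ wC u∈C v∈C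
    with t₁ , t₂ , wt₁ , wt₂ , t↭T ← closedWalk-split₂ wT v∈T u∈T
    with Ps₁ , cycles₁ , Ps₁↭ ← closedWalk⇒cycles (walk-++ ws₁ wt₁)
    with Ps₂ , cycles₂ , Ps₂↭ ← closedWalk⇒cycles (walk-++ ws₂ wt₂)
    with h , h∈s₁ ← walk-nonempty ws₁ u≢v
    with g , g∈s₂ ← walk-nonempty ws₂ (u≢v ∘ sym) =
    Ps₁ , Ps₂ , All.++⁺ cycles₁ cycles₂ , perm , h , g ,
    ∈-resp-↭ s↭C (∈-++⁺ˡ h∈s₁) , ∈-resp-↭ s↭C (∈-++⁺ʳ s₁ g∈s₂) ,
    ∈-resp-↭ (↭-sym Ps₁↭) (∈-++⁺ˡ h∈s₁) , ∈-resp-↭ (↭-sym Ps₂↭) (∈-++⁺ˡ g∈s₂)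
    where
      open PermutationReasoning
      perm : concat Ps₁ ++ concat Ps₂ ↭ _
      perm = begin
        concat Ps₁ ++ concat Ps₂    ↭⟨ ++⁺ Ps₁↭ Ps₂↭ ⟩
        (s₁ ++ t₁) ++ (s₂ ++ t₂)    ≡⟨ List.++-assoc s₁ t₁ _ ⟩
        s₁ ++ t₁ ++ s₂ ++ t₂        ↭⟨ ++⁺ˡ s₁ (shifts t₁ s₂) ⟩
        s₁ ++ s₂ ++ t₁ ++ t₂        ≡⟨ List.++-assoc s₁ s₂ _ ⟨
        (s₁ ++ s₂) ++ (t₁ ++ t₂)    ↭⟨ ++⁺ s↭C t↭T ⟩
        _                           ∎

  replace-blocks : ∀ {P Xs Ys R} → IsCyclePartition D P → P ↭ Xs ++ R → All (IsCycle D) Ys →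
                   concat Ys ↭ concat Xs → IsCyclePartition D (Ys ++ R)
  replace-blocks {P} {Xs} {Ys} {R} (cycles , unique , cover) P↭ Ys-cycles Ys↭Xs =
    All.++⁺ Ys-cycles (All.++⁻ʳ Xs (All-resp-↭ P↭ cycles)) ,
    Unique-resp-↭ (↭-sym N↭P) unique ,
    λ e → ∈-resp-↭ (↭-sym N↭P) (cover e)
    where
      open PermutationReasoning
      N↭P : concat (Ys ++ R) ↭ concat P
      N↭P = begin
        concat (Ys ++ R)         ≡⟨ List.concat-++ Ys R ⟨
        concat Ys ++ concat R    ↭⟨ ++⁺ Ys↭Xs refl ⟩
        concat Xs ++ concat R    ≡⟨ List.concat-++ Xs R ⟩
        concat (Xs ++ R)         ↭⟨ concat-↭ P↭ ⟨
        concat P                 ∎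

  endpoints∈cycle : ∀ {C e x y} → IsCycle D C → e ∈ C →
                    (src e ≡ x × tgt e ≡ y) ⊎ (src e ≡ y × tgt e ≡ x) → x ∈ map src C × y ∈ map src C
  endpoints∈cycle C-cycle e∈ ends with s∈ , t∈ ← cycle-endpoints C-cycle e∈ | ends
  ... | inj₁ (refl , refl) = s∈ , t∈
  ... | inj₂ (refl , refl) = t∈ , s∈

  module _ {P₀} (isP₀ : IsCyclePartition D P₀) where

    block-cycle : ∀ {C R} → P₀ ↭ C ∷ R → IsCycle D C
    block-cycle P₀↭ = All.head (All-resp-↭ P₀↭ (proj₁ isP₀))

    untouched⇒Adj-closed : ∀ {Q R x y} → P₀ ↭ Q ++ R → (∀ {X} → X ∈ R → ¬ Touches X Q) →
                           Adj D x y → x ∈ vertices Q → y ∈ vertices Q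
    untouched⇒Adj-closed {Q} {R} P₀↭ untouched (e , ends) x∈Q
      with X , e∈X , X∈ ← ∈-concat⁻′ (Q ++ R) (∈-resp-↭ (concat-↭ P₀↭) (proj₂ (proj₂ isP₀) e))
      with x∈X , y∈X ← endpoints∈cycle (All.lookup (All-resp-↭ P₀↭ (proj₁ isP₀)) X∈) e∈X ends
      with ∈-++⁻ Q X∈
    ... | inj₁ X∈Q = ∈-concat⁺′ y∈X (∈-map⁺ (map src) X∈Q)
    ... | inj₂ X∈R = ⊥-elim (untouched X∈R (lose x∈X x∈Q))

    untouched⇒spanning : Connected D → ∀ {Q R x} → P₀ ↭ Q ++ R → (∀ {X} → X ∈ R → ¬ Touches X Q) →
                         x ∈ vertices Q → ∀ y → y ∈ vertices Q
    untouched⇒spanning connected {Q} {x = x} P₀↭ untouched x∈Q y =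
      Star.fold (λ a b → a ∈ vertices Q → b ∈ vertices Q)
                (λ adj k → k ∘ untouched⇒Adj-closed P₀↭ untouched adj) (λ a∈ → a∈)
                (connected x y) x∈Q

    some-block-touches : Connected D → ∀ {Q X R} → ConnectedUnion Q → P₀ ↭ Q ++ X ∷ R →
                         Any (λ Y → Touches Y Q) (X ∷ R)
    some-block-touches connected {Q} {X} {R} union P₀↭
      with any? (λ Y → any? (_∈? vertices Q) (map src Y)) (X ∷ R)
    ... | yes touching = touching
    ... | no ¬touching =
      ⊥-elim (¬touching (here (let v , v∈X = cycle-vertex X-cycle in lose v∈X (spanning v))))
      where
        cycles : All (IsCycle D) (Q ++ X ∷ R)
        cycles = All-resp-↭ P₀↭ (proj₁ isP₀)
        spanning : ∀ y → y ∈ vertices Q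
        spanning = untouched⇒spanning connected P₀↭ (λ Y∈ touch → ¬touching (lose Y∈ touch))
                     (proj₂ (ConnectedUnion-vertex union (All.++⁻ˡ Q cycles)))
        X-cycle : IsCycle D X
        X-cycle = All.head (All.++⁻ʳ Q cycles)

    arrange-connected : Connected D → ∀ k {Q R} → length R ≡ k → ConnectedUnion Q → P₀ ↭ Q ++ R →
                        ∃ λ Q′ → ConnectedUnion Q′ × P₀ ↭ Q′
    arrange-connected _ _ {Q} {[]} _ union P₀↭ = Q , union , ↭-trans P₀↭ (++-identityʳ Q)
    arrange-connected connected (suc k) {Q} {X ∷ R} |R|≡ union P₀↭
      with Y , Y∈ , touch ← find (some-block-touches connected union P₀↭)
      with R′ , R↭ ← ∈-∃↭ Y∈ =
      arrange-connected connected k (ℕ.suc-injective (≡.trans (sym (↭-length R↭)) |R|≡))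
        (attach touch union) (↭-trans P₀↭ (↭-trans (++⁺ˡ Q R↭) (shift Y Q R′)))

    rerouted-partition : ∀ {C Q R u v} → P₀ ↭ C ∷ Q ++ R → ConnectedUnion Q →
                         u ∈ map src C → v ∈ map src C → u ∈ vertices Q → v ∈ vertices Q → u ≢ v →
                         ∃₂ λ Xs Ys → IsCyclePartition D (Xs ++ Ys) ×
                         ∃₂ λ h g → h ∈ C × g ∈ C × h ∈ concat Xs × g ∈ concat Ys
    rerouted-partition {C} {Q} {R} P₀↭ union u∈C v∈C u∈Q v∈Q u≢v
      with _ , T , wT , T↭Q ← eulerTour union (All.++⁻ˡ Q (All.tail (All-resp-↭ P₀↭ (proj₁ isP₀))))
      with _ , wC ← cycle⇒Walk (block-cycle P₀↭)
      with u∈T ← vertices-↭ {Q = Q} T↭Q u∈Q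
      with v∈T ← vertices-↭ {Q = Q} T↭Q v∈Q
      with Ps₁ , Ps₂ , cycles , Ps↭CT , h , g , h∈C , g∈C , h∈Ps₁ , g∈Ps₂
             ← reroute wC wT u∈C v∈C u∈T v∈T u≢v =
      Ps₁ , Ps₂ ++ R ,
      subst (IsCyclePartition D) (List.++-assoc Ps₁ Ps₂ R) (replace-blocks isP₀ P₀↭ cycles Ps↭CQ) ,
      h , g , h∈C , g∈C , h∈Ps₁ , subst (g ∈_) (List.concat-++ Ps₂ R) (∈-++⁺ˡ g∈Ps₂)
      where
        Ps↭CQ : concat (Ps₁ ++ Ps₂) ↭ C ++ concat Q
        Ps↭CQ = ↭-trans (↭-reflexive (sym (List.concat-++ Ps₁ Ps₂))) (↭-trans Ps↭CT (++⁺ˡ C T↭Q))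

    module _ (P₀-in-every : ∀ {N} → IsCyclePartition D N → All (λ C → Any (SameUpToRotation D C) N) P₀)
      where

      block-not-split : ∀ {C Xs Ys h g} → C ∈ P₀ → IsCyclePartition D (Xs ++ Ys) →
                        h ∈ C → g ∈ C → h ∈ concat Xs → g ∈ concat Ys → ⊥
      block-not-split {Xs = Xs} C∈P₀ isN h∈C g∈C h∈Xs g∈Ys
        with C′ , C′∈N , C~C′ ← find (All.lookup (P₀-in-every isN) C∈P₀) =
        no-straddling-block Xs (proj₁ (proj₂ isN)) C′∈N
          (∈-resp-↭ (rotation⇒↭ C~C′) h∈C) (∈-resp-↭ (rotation⇒↭ C~C′) g∈C) h∈Xs g∈Ys

      single-contact : ∀ {C Q R u v} → P₀ ↭ C ∷ Q ++ R → ConnectedUnion Q →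
                       u ∈ map src C → v ∈ map src C → u ∈ vertices Q → v ∈ vertices Q → u ≡ v
      single-contact {u = u} {v} P₀↭ union u∈C v∈C u∈Q v∈Q with u ≟ᶠ v
      ... | yes u≡v = u≡v
      ... | no u≢v =
        let Xs , Ys , isN , h , g , h∈C , g∈C , h∈Xs , g∈Ys =
              rerouted-partition P₀↭ union u∈C v∈C u∈Q v∈Q u≢v
        in ⊥-elim (block-not-split {Xs = Xs} {Ys} (∈-resp-↭ (↭-sym P₀↭) (here refl))
                                   isN h∈C g∈C h∈Xs g∈Ys)

      ConnectedUnion⇒InS : ∀ {Q R VS ES} → ConnectedUnion Q → P₀ ↭ Q ++ R →
                           (∀ v → v ∈ₛ VS ⇔ v ∈ vertices Q) → (∀ e → e ∈ₛ ES ⇔ e ∈ concat Q) →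
                           InS D VS ES
      ConnectedUnion⇒InS (single C) P₀↭ vertices⇔ edges⇔ =
        cycle (C , block-cycle P₀↭ ,
               subst (λ es → ∀ e → e ∈ₛ _ ⇔ e ∈ es) (List.++-identityʳ C) edges⇔ ,
               subst (λ vs → ∀ v → v ∈ₛ _ ⇔ v ∈ vs) (List.++-identityʳ (map src C)) vertices⇔)
      ConnectedUnion⇒InS {C ∷ Q} {R} (attach touch union) P₀↭ vertices⇔ edges⇔
        with w , w∈C , w∈Q ← find touch =
        glue (fromList (map src C)) (fromList C) (fromList (vertices Q)) (fromList (concat Q))
          (cycle (C , block-cycle P₀↭ , (λ _ → ∈-fromList) , (λ _ → ∈-fromList)))
          (ConnectedUnion⇒InS union (↭-trans P₀↭ (↭-sym (shift C Q R)))
                              (λ _ → ∈-fromList) (λ _ → ∈-fromList))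
          (w , λ u → mk⇔ (λ (u∈C , u∈Q) → single-contact P₀↭ union (Equivalence.to ∈-fromList u∈C) w∈C
                                                                   (Equivalence.to ∈-fromList u∈Q) w∈Q)
                         (λ { refl → Equivalence.from ∈-fromList w∈C , Equivalence.from ∈-fromList w∈Q }))
          (λ v → ⇔.trans (vertices⇔ v) ∈-++⇔∈-fromList)
          (λ e → ⇔.trans (edges⇔ e) ∈-++⇔∈-fromList)

      ConnectedUnion⇒InClassS : Connected D → ∀ {Q} → ConnectedUnion Q → P₀ ↭ Q → InClassS D
      ConnectedUnion⇒InClassS connected {Q} union P₀↭Q =
        ConnectedUnion⇒InS union (↭-trans P₀↭Q (↭-sym (++-identityʳ Q)))
          (λ v → mk⇔ (λ _ → spanning v) (λ _ → ∈⊤))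
          (λ e → mk⇔ (λ _ → ∈-resp-↭ (concat-↭ P₀↭Q) (proj₂ (proj₂ isP₀) e)) (λ _ → ∈⊤))
        where
          spanning : ∀ v → v ∈ vertices Q
          spanning = untouched⇒spanning connected {Q} {[]} (↭-trans P₀↭Q (↭-sym (++-identityʳ Q)))
                       (λ ()) (proj₂ (ConnectedUnion-vertex union (All-resp-↭ P₀↭Q (proj₁ isP₀))))

  HasUniqueCyclePartition⇒InClassS : Connected D → Fin m → HasUniqueCyclePartition D → InClassS D
  HasUniqueCyclePartition⇒InClassS _ e₀ (([] , _ , _ , cover) , _) with () ← cover e₀
  HasUniqueCyclePartition⇒InClassS connected _ ((C₀ ∷ R₀ , isP₀) , unique) =
    let Q , union , P₀↭Q = arrange-connected isP₀ connected _ refl (single C₀) refl in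
    ConnectedUnion⇒InClassS isP₀ (λ isN → proj₁ (unique _ _ isP₀ isN)) connected union P₀↭Q

Eulerian⇒edge : (D : Digraph) → Eulerian D → Fin (Digraph.m D)
Eulerian⇒edge D (e ∷ _ , _) = e

-- Eulerianity is only used to know that D has an edge, so that its cycle partition is nonempty.
mainTheorem9 : (D : Digraph) → Connected D → Eulerian D →
    (HasUniqueCyclePartition D ⇔ InClassS D)
mainTheorem9 D connected eulerian =
  mk⇔ (HasUniqueCyclePartition⇒InClassS D connected (Eulerian⇒edge D eulerian))
      (InClassS⇒HasUniqueCyclePartition D)
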